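{- Let $2k+1$ be a prime and let $G$ be a finite simple graph on $n$ vertices that admits a $(2k+1)$-neighborhood balanced coloring. Then for any $(2k+1)$-neighborhood balanced coloring $\sigma$ of $G$ and all $i\neq j$ in $\{1,\dots,2k+1\}$, $$\sigma(R_iR_j)=\frac{2|E(G)|}{(2k+1)^2}\quad\text{and}\quad \sigma(R_iR_i)=\frac{|E(G)|}{(2k+1)^2}.$$
   Context: Graphs are finite and simple. For a prime $2k+1$ (with $k\ge 1$), a $(2k+1)$-neighborhood balanced coloring of a graph $G$ is an assignment to each vertex of one of $2k+1$ colors $R_1,\dots,R_{2k+1}$ such that every vertex has an equal number of neighbors of each color. For such a coloring $\sigma$, $\sigma(R_iR_j)$ (for $i\ne j$) denotes the number of edges with one endpoint colored $R_i$ and the other colored $R_j$, and $\sigma(R_iR_i)$ denotes the number of edges both of whose endpoints are colored $R_i$. -}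

module Defs where

open import Data.Nat using (ℕ; zero; suc; _+_; _*_; _<_)
open import Data.Nat.Properties using (_<?_)
open import Data.Fin using (Fin; toℕ)
open import Data.Bool using (Bool; true; false; if_then_else_; _∧_)
open import Relation.Binary.PropositionalEquality using (_≡_)
open import Relation.Nullary.Decidable using (⌊_⌋)
open import Data.Fin using (_≟_)

sumFin : (n : ℕ) → (Fin n → ℕ) → ℕ
sumFin zero    f = 0
sumFin (suc n) f = f Fin.zero + sumFin n (λ i → f (Fin.suc i))

countFin : (n : ℕ) → (Fin n → Bool) → ℕ
countFin n p = sumFin n (λ i → if p i then 1 else 0)

record Graph (n : ℕ) : Set where
  field
    adj     : Fin n → Fin n → Bool
    sym     : ∀ u v → adj u v ≡ adj v u
    irrefl  : ∀ v → adj v v ≡ false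

open Graph public

-- Boolean "u < v" on vertices (used to count each unordered edge once).
ltB : {n : ℕ} → Fin n → Fin n → Bool
ltB u v = ⌊ toℕ u <? toℕ v ⌋

eqB : {m : ℕ} → Fin m → Fin m → Bool
eqB a b = ⌊ a ≟ b ⌋

edgeCount : {n : ℕ} → Graph n → ℕ
edgeCount {n} G = sumFin n (λ u → countFin n (λ v → ltB u v ∧ adj G u v))

-- A colouring with m colours (colours R_1..R_m are Fin m).
Coloring : ℕ → ℕ → Set
Coloring n m = Fin n → Fin m

nbrsOfColor : {n m : ℕ} → Graph n → Coloring n m → Fin n → Fin m → ℕ
nbrsOfColor {n} G σ v c = countFin n (λ u → adj G v u ∧ eqB (σ u) c)

IsNeighborhoodBalanced : {n m : ℕ} → Graph n → Coloring n m → Set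
IsNeighborhoodBalanced G σ = ∀ v a b → nbrsOfColor G σ v a ≡ nbrsOfColor G σ v b

edgeColoredB : {n m : ℕ} → Coloring n m → Fin m → Fin m → Fin n → Fin n → Bool
edgeColoredB σ a b u v =
  (eqB (σ u) a ∧ eqB (σ v) b) Data.Bool.∨ (eqB (σ u) b ∧ eqB (σ v) a)

colorEdgeCount : {n m : ℕ} → Graph n → Coloring n m → Fin m → Fin m → ℕ
colorEdgeCount {n} G σ a b =
  sumFin n (λ u → countFin n (λ v → ltB u v ∧ adj G u v ∧ edgeColoredB σ a b u v))

-- Count the ordered pairs (u, v) of adjacent vertices with σ u = a and σ v = b.
-- Grouping them by u gives the sum over a-coloured u of the number of
-- b-coloured neighbours, which by balance does not depend on b; since the count
-- is also symmetric in a and b, it is one constant N for all m² pairs of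
-- colours.  Every edge is counted twice overall, so m² N = 2|E|.  An edge with
-- colours {a, b}, a ≠ b, is one arc a → b and one arc b → a, whence
-- 2 σ(R_a R_b) = 2N, while a monochromatic edge is two arcs a → a, whence
-- 2 σ(R_a R_a) = N.
module Submission where

open import Defs
open import Data.Nat using (ℕ; _+_; _*_; _^_)
open import Data.Nat.Primality using (Prime)
open import Data.Fin using (Fin)
open import Data.Product using (_×_; ∃)
open import Relation.Binary.PropositionalEquality using (_≡_)
open import Relation.Nullary using (¬_)

open import Algebra.Bundles using (CommutativeMonoid)
open import Data.Bool using (Bool; true; false; if_then_else_; _∧_; _∨_)
open import Data.Bool.Properties using (∧-commutativeMonoid; ∧-zeroʳ; ∨-comm; ∨-identityʳ; ∨-idem)
open import Data.Empty using (⊥-elim)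
open import Data.Fin using (zero; suc; toℕ; _≟_)
open import Data.Fin.Properties using (toℕ-injective)
open import Data.Nat using (zero; suc; _<?_)
open import Data.Nat.Properties
  using (+-*-semiring; *-commutativeSemigroup; +-identityʳ; *-identityˡ; *-identityʳ; *-assoc; *-comm;
         *-cancelˡ-≡; <-asym; ≤-antisym; ≮⇒≥)
open import Data.Product using (_,_)
open import Relation.Binary.PropositionalEquality using (_≢_; refl; trans; cong; cong₂; subst; module ≡-Reasoning)
import Relation.Binary.PropositionalEquality as ≡
open import Relation.Nullary using (yes; no)
open import Relation.Nullary.Decidable using (⌊⌋-map′)

open import Algebra.Properties.Semiring.Sum +-*-semiring
  using (sum; sum-syntax; sum-cong-≗; sum-replicate-zero; ∑-comm; ∑-distrib-+; *-distribˡ-sum; *-distribʳ-sum)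
open import Algebra.Properties.CommutativeSemigroup (CommutativeMonoid.commutativeSemigroup ∧-commutativeMonoid)
  using () renaming (x∙yz≈z∙yx to ∧-reverse)
open import Algebra.Properties.CommutativeSemigroup *-commutativeSemigroup
  using () renaming (x∙yz≈y∙xz to *-left-comm)

open ≡-Reasoning

𝟙 : Bool → ℕ
𝟙 b = if b then 1 else 0

𝟙-∧ : ∀ x y → 𝟙 (x ∧ y) ≡ 𝟙 x * 𝟙 y
𝟙-∧ false y = refl
𝟙-∧ true  y = ≡.sym (+-identityʳ (𝟙 y))

𝟙-∨-exclusive : ∀ x y → (x ≡ true → y ≡ false) → 𝟙 (x ∨ y) ≡ 𝟙 x + 𝟙 y
𝟙-∨-exclusive false y _    = refl
𝟙-∨-exclusive true  y excl rewrite excl refl = refl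

∧-trueˡ : ∀ x y → x ∧ y ≡ true → x ≡ true
∧-trueˡ true y _ = refl

∧-distribˡ-∨-inside : ∀ x p q r s → x ∧ (p ∧ q ∨ r ∧ s) ≡ p ∧ x ∧ q ∨ r ∧ x ∧ s
∧-distribˡ-∨-inside true  p q r s = refl
∧-distribˡ-∨-inside false p q r s = ≡.sym (cong₂ _∨_ (∧-zeroʳ p) (∧-zeroʳ r))

eqB-exclusive : ∀ {m} {a b : Fin m} → a ≢ b → ∀ x → eqB x a ≡ true → eqB x b ≡ false
eqB-exclusive {a = a} {b} a≢b x with x ≟ a | x ≟ b
... | yes x≡a | yes x≡b = ⊥-elim (a≢b (trans (≡.sym x≡a) x≡b))
... | yes _   | no _    = λ _ → refl
... | no _    | _       = λ ()

ltB-asym : ∀ {n} (u v : Fin n) → ltB u v ≡ true → ltB v u ≡ false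
ltB-asym u v with toℕ u <? toℕ v | toℕ v <? toℕ u
... | yes u<v | yes v<u = ⊥-elim (<-asym u<v v<u)
... | _       | no _    = λ _ → refl
... | no _    | yes _   = λ ()

split-by-ltB : ∀ {n} (R : Fin n → Fin n → Bool) → (∀ u → R u u ≡ false) →
               ∀ u v → R u v ≡ (ltB u v ∧ R u v) ∨ (ltB v u ∧ R u v)
split-by-ltB R irrefl u v with toℕ u <? toℕ v | toℕ v <? toℕ u
... | yes u<v | yes v<u = ⊥-elim (<-asym u<v v<u)
... | yes _   | no _    = ≡.sym (∨-identityʳ (R u v))
... | no _    | yes _   = refl
... | no u≮v  | no v≮u  =
  subst (λ w → R u w ≡ false) (toℕ-injective (≤-antisym (≮⇒≥ v≮u) (≮⇒≥ u≮v))) (irrefl u)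

sumFin≡sum : ∀ n (f : Fin n → ℕ) → sumFin n f ≡ sum f
sumFin≡sum zero    f = refl
sumFin≡sum (suc n) f = cong (f zero +_) (sumFin≡sum n (λ i → f (suc i)))

∑-const : ∀ n c → ∑[ i < n ] c ≡ n * c
∑-const zero    c = refl
∑-const (suc n) c = cong (c +_) (∑-const n c)

∑-eqB : ∀ {m} (x : Fin m) → ∑[ a < m ] 𝟙 (eqB x a) ≡ 1
∑-eqB {suc m} zero    = cong (1 +_) (sum-replicate-zero m)
∑-eqB {suc m} (suc x) = trans (sum-cong-≗ λ a → cong 𝟙 (⌊⌋-map′ _ _ (x ≟ a))) (∑-eqB x)

∑-fibres : ∀ {n m} (σ : Fin n → Fin m) (f : Fin n → ℕ) →
           ∑[ a < m ] ∑[ u < n ] (𝟙 (eqB (σ u) a) * f u) ≡ ∑[ u < n ] f u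
∑-fibres {n} {m} σ f = trans (∑-comm {m} {n} _) (sum-cong-≗ λ u → begin
  ∑[ a < m ] (𝟙 (eqB (σ u) a) * f u)  ≡⟨ *-distribʳ-sum (f u) (λ a → 𝟙 (eqB (σ u) a)) ⟨
  (∑[ a < m ] 𝟙 (eqB (σ u) a)) * f u  ≡⟨ cong (_* f u) (∑-eqB (σ u)) ⟩
  1 * f u                             ≡⟨ *-identityˡ (f u) ⟩
  f u                                 ∎)

pairCount : ∀ {n} → (Fin n → Fin n → Bool) → ℕ
pairCount {n} R = ∑[ u < n ] ∑[ v < n ] 𝟙 (R u v)

sumFin-countFin≡pairCount : ∀ {n} (R : Fin n → Fin n → Bool) →
                            sumFin n (λ u → countFin n (R u)) ≡ pairCount R
sumFin-countFin≡pairCount {n} R = trans (sumFin≡sum n _) (sum-cong-≗ λ u → sumFin≡sum n (λ v → 𝟙 (R u v)))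

pairCount-cong : ∀ {n} {R S : Fin n → Fin n → Bool} → (∀ u v → R u v ≡ S u v) → pairCount R ≡ pairCount S
pairCount-cong R≡S = sum-cong-≗ λ u → sum-cong-≗ λ v → cong 𝟙 (R≡S u v)

pairCount-flip : ∀ {n} (R : Fin n → Fin n → Bool) → pairCount (λ u v → R v u) ≡ pairCount R
pairCount-flip R = ≡.sym (∑-comm (λ u v → 𝟙 (R u v)))

pairCount-∨ : ∀ {n} (R S : Fin n → Fin n → Bool) → (∀ u v → R u v ≡ true → S u v ≡ false) →
              pairCount (λ u v → R u v ∨ S u v) ≡ pairCount R + pairCount S
pairCount-∨ {n} R S excl = trans
  (sum-cong-≗ λ u → trans (sum-cong-≗ λ v → 𝟙-∨-exclusive (R u v) (S u v) (excl u v)) (∑-distrib-+ {n} _ _))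
  (∑-distrib-+ {n} _ _)

pairCount-halve : ∀ {n} (R : Fin n → Fin n → Bool) → (∀ u v → R u v ≡ R v u) → (∀ u → R u u ≡ false) →
                  2 * pairCount (λ u v → ltB u v ∧ R u v) ≡ pairCount R
pairCount-halve R R-sym R-irrefl = ≡.sym (begin
  pairCount R
    ≡⟨ pairCount-cong (split-by-ltB R R-irrefl) ⟩
  pairCount (λ u v → (ltB u v ∧ R u v) ∨ (ltB v u ∧ R u v))
    ≡⟨ pairCount-∨ _ _ (λ u v lt → cong (_∧ R u v) (ltB-asym u v (∧-trueˡ _ _ lt))) ⟩
  below + pairCount (λ u v → ltB v u ∧ R u v)
    ≡⟨ cong (below +_) (pairCount-cong λ u v → cong (ltB v u ∧_) (R-sym u v)) ⟩
  below + pairCount (λ u v → ltB v u ∧ R v u)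
    ≡⟨ cong (below +_) (pairCount-flip (λ u v → ltB u v ∧ R u v)) ⟩
  below + below
    ≡⟨ cong (below +_) (+-identityʳ below) ⟨
  2 * below ∎)
  where below = pairCount (λ u v → ltB u v ∧ R u v)

twice-edgeCount : ∀ {n} (G : Graph n) → 2 * edgeCount G ≡ pairCount (adj G)
twice-edgeCount G = trans (cong (2 *_) (sumFin-countFin≡pairCount (λ u v → ltB u v ∧ adj G u v)))
                          (pairCount-halve (adj G) (Graph.sym G) (Graph.irrefl G))

module _ {n m : ℕ} (G : Graph n) (σ : Coloring n m) where

  arc : Fin m → Fin m → Fin n → Fin n → Bool
  arc a b u v = eqB (σ u) a ∧ adj G u v ∧ eqB (σ v) b

  arcCount : Fin m → Fin m → ℕ
  arcCount a b = pairCount (arc a b)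

  arc-flip : ∀ a b u v → arc a b u v ≡ arc b a v u
  arc-flip a b u v = trans (∧-reverse (eqB (σ u) a) (adj G u v) (eqB (σ v) b))
                           (cong (λ e → eqB (σ v) b ∧ e ∧ eqB (σ u) a) (Graph.sym G u v))

  arcCount-sym : ∀ a b → arcCount a b ≡ arcCount b a
  arcCount-sym a b = trans (pairCount-cong (arc-flip a b)) (pairCount-flip (arc b a))

  arcCount≡∑nbrsOfColor : ∀ a b → arcCount a b ≡ ∑[ u < n ] (𝟙 (eqB (σ u) a) * nbrsOfColor G σ u b)
  arcCount≡∑nbrsOfColor a b = sum-cong-≗ λ u → begin
    ∑[ v < n ] 𝟙 (arc a b u v)
      ≡⟨ sum-cong-≗ (λ v → 𝟙-∧ (eqB (σ u) a) (adj G u v ∧ eqB (σ v) b)) ⟩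
    ∑[ v < n ] (𝟙 (eqB (σ u) a) * 𝟙 (adj G u v ∧ eqB (σ v) b))
      ≡⟨ *-distribˡ-sum (𝟙 (eqB (σ u) a)) (λ v → 𝟙 (adj G u v ∧ eqB (σ v) b)) ⟨
    𝟙 (eqB (σ u) a) * ∑[ v < n ] 𝟙 (adj G u v ∧ eqB (σ v) b)
      ≡⟨ cong (𝟙 (eqB (σ u) a) *_) (sumFin≡sum n (λ v → 𝟙 (adj G u v ∧ eqB (σ v) b))) ⟨
    𝟙 (eqB (σ u) a) * nbrsOfColor G σ u b ∎

  ∑nbrsOfColor : ∀ u → ∑[ b < m ] nbrsOfColor G σ u b ≡ ∑[ v < n ] 𝟙 (adj G u v)
  ∑nbrsOfColor u = begin
    ∑[ b < m ] nbrsOfColor G σ u b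
      ≡⟨ sum-cong-≗ (λ b → sumFin≡sum n (λ v → 𝟙 (adj G u v ∧ eqB (σ v) b))) ⟩
    ∑[ b < m ] ∑[ v < n ] 𝟙 (adj G u v ∧ eqB (σ v) b)
      ≡⟨ sum-cong-≗ (λ b → sum-cong-≗ λ v → commuted b v) ⟩
    ∑[ b < m ] ∑[ v < n ] (𝟙 (eqB (σ v) b) * 𝟙 (adj G u v))
      ≡⟨ ∑-fibres σ (λ v → 𝟙 (adj G u v)) ⟩
    ∑[ v < n ] 𝟙 (adj G u v) ∎
    where
    commuted : ∀ b v → 𝟙 (adj G u v ∧ eqB (σ v) b) ≡ 𝟙 (eqB (σ v) b) * 𝟙 (adj G u v)
    commuted b v = trans (𝟙-∧ (adj G u v) _) (*-comm (𝟙 (adj G u v)) _)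

  ∑∑arcCount : ∑[ a < m ] ∑[ b < m ] arcCount a b ≡ pairCount (adj G)
  ∑∑arcCount = begin
    ∑[ a < m ] ∑[ b < m ] arcCount a b
      ≡⟨ sum-cong-≗ (λ a → sum-cong-≗ (arcCount≡∑nbrsOfColor a)) ⟩
    ∑[ a < m ] ∑[ b < m ] ∑[ u < n ] (𝟙 (eqB (σ u) a) * nbrsOfColor G σ u b)
      ≡⟨ sum-cong-≗ (λ a → ∑-comm (λ b u → 𝟙 (eqB (σ u) a) * nbrsOfColor G σ u b)) ⟩
    ∑[ a < m ] ∑[ u < n ] ∑[ b < m ] (𝟙 (eqB (σ u) a) * nbrsOfColor G σ u b)
      ≡⟨ sum-cong-≗ (λ a → sum-cong-≗ λ u → *-distribˡ-sum (𝟙 (eqB (σ u) a)) (nbrsOfColor G σ u)) ⟨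
    ∑[ a < m ] ∑[ u < n ] (𝟙 (eqB (σ u) a) * ∑[ b < m ] nbrsOfColor G σ u b)
      ≡⟨ sum-cong-≗ (λ a → sum-cong-≗ λ u → cong (𝟙 (eqB (σ u) a) *_) (∑nbrsOfColor u)) ⟩
    ∑[ a < m ] ∑[ u < n ] (𝟙 (eqB (σ u) a) * ∑[ v < n ] 𝟙 (adj G u v))
      ≡⟨ ∑-fibres σ (λ u → ∑[ v < n ] 𝟙 (adj G u v)) ⟩
    pairCount (adj G) ∎

  adj∧edgeColoredB : ∀ a b u v → adj G u v ∧ edgeColoredB σ a b u v ≡ arc a b u v ∨ arc b a u v
  adj∧edgeColoredB a b u v =
    ∧-distribˡ-∨-inside (adj G u v) (eqB (σ u) a) (eqB (σ v) b) (eqB (σ u) b) (eqB (σ v) a)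

  twice-colorEdgeCount : ∀ a b → 2 * colorEdgeCount G σ a b ≡ pairCount (λ u v → arc a b u v ∨ arc b a u v)
  twice-colorEdgeCount a b = begin
    2 * colorEdgeCount G σ a b               ≡⟨ cong (2 *_) (sumFin-countFin≡pairCount (λ u v → ltB u v ∧ E u v)) ⟩
    2 * pairCount (λ u v → ltB u v ∧ E u v)  ≡⟨ pairCount-halve E E-sym E-irrefl ⟩
    pairCount E                              ≡⟨ pairCount-cong (adj∧edgeColoredB a b) ⟩
    pairCount (λ u v → arc a b u v ∨ arc b a u v) ∎
    where
    E : Fin n → Fin n → Bool
    E u v = adj G u v ∧ edgeColoredB σ a b u v

    E-sym : ∀ u v → E u v ≡ E v u
    E-sym u v = begin
      E u v                          ≡⟨ adj∧edgeColoredB a b u v ⟩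
      arc a b u v ∨ arc b a u v      ≡⟨ cong₂ _∨_ (arc-flip a b u v) (arc-flip b a u v) ⟩
      arc b a v u ∨ arc a b v u      ≡⟨ ∨-comm (arc b a v u) _ ⟩
      arc a b v u ∨ arc b a v u      ≡⟨ adj∧edgeColoredB a b v u ⟨
      E v u                          ∎

    E-irrefl : ∀ u → E u u ≡ false
    E-irrefl u = cong (_∧ edgeColoredB σ a b u u) (Graph.irrefl G u)

  twice-colorEdgeCount-distinct : ∀ {a b} → a ≢ b → 2 * colorEdgeCount G σ a b ≡ arcCount a b + arcCount b a
  twice-colorEdgeCount-distinct {a} {b} a≢b =
    trans (twice-colorEdgeCount a b) (pairCount-∨ (arc a b) (arc b a) exclusive)
    where
    exclusive : ∀ u v → arc a b u v ≡ true → arc b a u v ≡ false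
    exclusive u v ab = cong (_∧ adj G u v ∧ eqB (σ v) a) (eqB-exclusive a≢b (σ u) (∧-trueˡ _ _ ab))

  twice-colorEdgeCount-same : ∀ a → 2 * colorEdgeCount G σ a a ≡ arcCount a a
  twice-colorEdgeCount-same a = trans (twice-colorEdgeCount a a) (pairCount-cong λ u v → ∨-idem (arc a a u v))

  module _ (balanced : IsNeighborhoodBalanced G σ) where

    arcCount-balanced : ∀ a b c → arcCount a b ≡ arcCount a c
    arcCount-balanced a b c = begin
      arcCount a b                                        ≡⟨ arcCount≡∑nbrsOfColor a b ⟩
      ∑[ u < n ] (𝟙 (eqB (σ u) a) * nbrsOfColor G σ u b)  ≡⟨ sum-cong-≗ (λ u → cong (𝟙 (eqB (σ u) a) *_) (balanced u b c)) ⟩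
      ∑[ u < n ] (𝟙 (eqB (σ u) a) * nbrsOfColor G σ u c)  ≡⟨ arcCount≡∑nbrsOfColor a c ⟨
      arcCount a c                                        ∎

    arcCount-constant : ∀ a b c d → arcCount a b ≡ arcCount c d
    arcCount-constant a b c d = begin
      arcCount a b  ≡⟨ arcCount-balanced a b d ⟩
      arcCount a d  ≡⟨ arcCount-sym a d ⟩
      arcCount d a  ≡⟨ arcCount-balanced d a c ⟩
      arcCount d c  ≡⟨ arcCount-sym d c ⟩
      arcCount c d  ∎

    m²*arcCount : ∀ c → m ^ 2 * arcCount c c ≡ 2 * edgeCount G
    m²*arcCount c = begin
      m ^ 2 * arcCount c c
        ≡⟨ cong (_* arcCount c c) (cong (m *_) (*-identityʳ m)) ⟩
      m * m * arcCount c c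
        ≡⟨ *-assoc m m _ ⟩
      m * (m * arcCount c c)
        ≡⟨ trans (sum-cong-≗ {m} λ a → ∑-const m (arcCount c c)) (∑-const m (m * arcCount c c)) ⟨
      ∑[ a < m ] ∑[ b < m ] arcCount c c
        ≡⟨ sum-cong-≗ (λ a → sum-cong-≗ λ b → arcCount-constant c c a b) ⟩
      ∑[ a < m ] ∑[ b < m ] arcCount a b
        ≡⟨ ∑∑arcCount ⟩
      pairCount (adj G)
        ≡⟨ twice-edgeCount G ⟨
      2 * edgeCount G ∎

    colorEdgeCount-distinct : ∀ {a b} → a ≢ b → ∀ c → colorEdgeCount G σ a b ≡ arcCount c c
    colorEdgeCount-distinct {a} {b} a≢b c = *-cancelˡ-≡ _ _ 2 (begin
      2 * colorEdgeCount G σ a b   ≡⟨ twice-colorEdgeCount-distinct a≢b ⟩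
      arcCount a b + arcCount b a  ≡⟨ cong₂ _+_ (arcCount-constant a b c c) (arcCount-constant b a c c) ⟩
      arcCount c c + arcCount c c  ≡⟨ cong (arcCount c c +_) (+-identityʳ _) ⟨
      2 * arcCount c c             ∎)

theorem2p2 : (k : ℕ) → 1 Data.Nat.≤ k → Prime (2 * k + 1) →
    (n : ℕ) (G : Graph n) →
    ∃ (λ (τ : Coloring n (2 * k + 1)) → IsNeighborhoodBalanced G τ) →
    (σ : Coloring n (2 * k + 1)) → IsNeighborhoodBalanced G σ →
    (∀ (i j : Fin (2 * k + 1)) → ¬ (i ≡ j) →
      (2 * k + 1) ^ 2 * colorEdgeCount G σ i j ≡ 2 * edgeCount G)
    × (∀ (i : Fin (2 * k + 1)) →
      (2 * k + 1) ^ 2 * colorEdgeCount G σ i i ≡ edgeCount G)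
theorem2p2 k _ _ n G _ σ balanced = distinct , same
  where
  m = 2 * k + 1

  distinct : ∀ i j → i ≢ j → m ^ 2 * colorEdgeCount G σ i j ≡ 2 * edgeCount G
  distinct i j i≢j = trans (cong (m ^ 2 *_) (colorEdgeCount-distinct G σ balanced i≢j i))
                           (m²*arcCount G σ balanced i)

  same : ∀ i → m ^ 2 * colorEdgeCount G σ i i ≡ edgeCount G
  same i = *-cancelˡ-≡ _ _ 2 (begin
    2 * (m ^ 2 * colorEdgeCount G σ i i)  ≡⟨ *-left-comm 2 (m ^ 2) _ ⟩
    m ^ 2 * (2 * colorEdgeCount G σ i i)  ≡⟨ cong (m ^ 2 *_) (twice-colorEdgeCount-same G σ i) ⟩
    m ^ 2 * arcCount G σ i i              ≡⟨ m²*arcCount G σ balanced i ⟩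
    2 * edgeCount G                       ∎)
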